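{- Let $q$ be a positive integer and let $i_1,\dots,i_q$ be nonnegative integers, not all zero. Let $j_1,\dots,j_t$ be the distinct elements of the multiset $\{i_1,\dots,i_q\}$, appearing with multiplicities $k_1,\dots,k_t$ respectively. Then $q$ divides \[\binom{i_1+\dots+i_q}{i_1,\dots,i_q}\binom{q}{k_1,\dots,k_t}.\]
   Context: $\binom{N}{a_1,\dots,a_s}=\frac{N!}{a_1!\cdots a_s!}$ denotes the multinomial coefficient (with $a_1+\dots+a_s=N$). -}

module Defs where

open import Data.Nat using (ℕ; zero; suc; _*_; _/_; NonZero; _≟_)
open import Data.Nat.Properties using (m*n≢0; _!≢0)
open import Data.Nat.Combinatorics using ()
open import Data.Nat.Base using (_!)
open import Data.Nat.ListAction using (sum)
open import Data.List using (List; []; _∷_; map; product; length; filter; deduplicate)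
open import Data.Vec using (Vec; toList)

factProd : List ℕ → ℕ
factProd []       = 1
factProd (a ∷ as) = a ! * factProd as

factProd≢0 : (as : List ℕ) → NonZero (factProd as)
factProd≢0 []       = _
factProd≢0 (a ∷ as) = m*n≢0 (a !) (factProd as) {{a !≢0}} {{factProd≢0 as}}

multinomial : List ℕ → ℕ
multinomial as = (sum as ! / factProd as) {{factProd≢0 as}}

distinct : List ℕ → List ℕ
distinct = deduplicate _≟_

multiplicity : ℕ → List ℕ → ℕ
multiplicity j is = length (filter (_≟ j) is)

multiplicities : List ℕ → List ℕ
multiplicities is = map (λ j → multiplicity j is) (distinct is)

module Submission where

-- Let N = i₁+⋯+i_q = n+1 (positive, since some iᵣ ≠ 0), and let
-- F₁ = ∏ᵣ iᵣ! and F₂ = ∏ₛ kₛ!, so that multinomial(i)·F₁ = N! and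
-- multinomial(k)·F₂ = q! (the kₛ sum to q).  Then
--   multinomial(i)·multinomial(k)·F₁F₂ = N!·q! = q·(N!·(q−1)!),
-- so, cancelling F₁F₂, it suffices to prove F₁F₂ ∣ N!·(q−1)!.  Grouping the
-- entries of i by value gives N = Σⱼ kⱼ·j over the distinct values j, hence
--   N!·(q−1)! = Σⱼ (j·n!)·(kⱼ·(q−1)!),
-- and each summand is divisible by F₁F₂ because, for any member a of a list
-- with sum m+1, the product of the factorials of the list divides a·m!.

open import Defs
open import Data.Nat using (ℕ; _*_; _≤_)
open import Data.Nat.Divisibility using (_∣_)
open import Data.Fin using (Fin)
open import Data.Vec using (Vec; toList; lookup)
open import Data.Product using (∃)
open import Relation.Binary.PropositionalEquality using (_≢_)

open import Data.Nat using (zero; suc; _+_; _≟_; NonZero)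
open import Data.Nat.Base using (_!)
open import Data.Nat.Properties
  using ( m≤m+n; m≤n+m; ≤-trans; m+n∸m≡n; suc-injective; +-suc; *-assoc; *-comm
        ; *-identityˡ; *-identityʳ; *-distribʳ-+; *-cancelʳ-≡; m*n≢0; n≤0⇒n≡0
        ; *-commutativeSemigroup; +-commutativeSemigroup )
open import Data.Nat.Divisibility
  using (divides; ∣-refl; ∣-trans; _∣0; ∣m∣n⇒∣m+n; *-pres-∣; *-monoʳ-∣; module ∣-Reasoning)
open import Data.Nat.Combinatorics using (k![n∸k]!∣n!)
open import Data.Nat.DivMod using (m/n*n≡m)
open import Data.Nat.ListAction using (sum)
open import Data.List using (List; []; _∷_; map; length)
open import Data.List.Properties using (filter-accept; filter-reject; map-id; map-cong-local)
open import Data.List.Membership.Propositional using (_∈_)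
open import Data.List.Membership.Propositional.Properties using (∈-map⁺; deduplicate-∈⇔)
open import Data.List.Relation.Unary.Any using (here; there)
open import Data.List.Relation.Unary.All using (All; []; _∷_; tabulate)
import Data.List.Relation.Unary.All as All
open import Data.List.Relation.Unary.AllPairs using ([]; _∷_)
open import Data.List.Relation.Unary.Unique.Propositional using (Unique)
open import Data.List.Relation.Unary.Unique.DecPropositional.Properties _≟_ using (deduplicate-!)
open import Data.Vec.Properties using (length-toList)
open import Data.Vec.Membership.Propositional.Properties using (∈-lookup; ∈-toList⁺)
open import Data.Product using (_,_)
open import Data.Empty using (⊥-elim)
open import Function.Bundles using (Equivalence)
open import Relation.Nullary using (yes; no)
open import Relation.Binary.PropositionalEquality using (_≡_; refl; sym; trans; cong; cong₂; subst; subst₂; module ≡-Reasoning)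
open import Algebra.Properties.CommutativeSemigroup *-commutativeSemigroup
  using () renaming (interchange to *-interchange; x∙yz≈y∙xz to *-left-comm)
open import Algebra.Properties.CommutativeSemigroup +-commutativeSemigroup
  using () renaming (interchange to +-interchange)

sum-map-+ : ∀ {A : Set} (f g : A → ℕ) xs →
  sum (map (λ x → f x + g x) xs) ≡ sum (map f xs) + sum (map g xs)
sum-map-+ f g []       = refl
sum-map-+ f g (x ∷ xs) = trans (cong (f x + g x +_) (sum-map-+ f g xs))
                               (+-interchange (f x) (g x) (sum (map f xs)) (sum (map g xs)))

sum-map-*ʳ : ∀ {A : Set} (f : A → ℕ) c xs → sum (map f xs) * c ≡ sum (map (λ x → f x * c) xs)
sum-map-*ʳ f c []       = refl
sum-map-*ʳ f c (x ∷ xs) = trans (*-distribʳ-+ c (f x) (sum (map f xs)))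
                                (cong (f x * c +_) (sum-map-*ʳ f c xs))

sum-map-cong : ∀ {A : Set} {f g : A → ℕ} xs → (∀ {x} → x ∈ xs → f x ≡ g x) →
  sum (map f xs) ≡ sum (map g xs)
sum-map-cong xs f≡g = cong sum (map-cong-local (tabulate f≡g))

∣-sum : ∀ {A : Set} {d} (f : A → ℕ) xs → (∀ {x} → x ∈ xs → d ∣ f x) → d ∣ sum (map f xs)
∣-sum f []       d∣f = _ ∣0
∣-sum f (x ∷ xs) d∣f = ∣m∣n⇒∣m+n (d∣f (here refl)) (∣-sum f xs (λ x∈xs → d∣f (there x∈xs)))

sum-ones : ∀ {A : Set} (xs : List A) → sum (map (λ _ → 1) xs) ≡ length xs
sum-ones []       = refl
sum-ones (x ∷ xs) = cong suc (sum-ones xs)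

member≤sum : ∀ {a as} → a ∈ as → a ≤ sum as
member≤sum {a} {_ ∷ as} (here refl) = m≤m+n a (sum as)
member≤sum {a} {b ∷ as} (there a∈as) = ≤-trans (member≤sum a∈as) (m≤n+m (sum as) b)

sum-positive : ∀ {a as} → a ∈ as → a ≢ 0 → ∃ (λ n → sum as ≡ suc n)
sum-positive {as = as} a∈as a≢0 with sum as | member≤sum a∈as
... | zero  | a≤0 = ⊥-elim (a≢0 (n≤0⇒n≡0 a≤0))
... | suc n | _   = n , refl

factorials∣factorial-of-sum : ∀ a b → a ! * b ! ∣ (a + b) !
factorials∣factorial-of-sum a b =
  subst (λ t → a ! * t ! ∣ (a + b) !) (m+n∸m≡n a b) (k![n∸k]!∣n! (m≤m+n a b))

factProd∣sum! : ∀ as → factProd as ∣ sum as !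
factProd∣sum! []       = ∣-refl
factProd∣sum! (a ∷ as) =
  ∣-trans (*-monoʳ-∣ (a !) (factProd∣sum! as)) (factorials∣factorial-of-sum a (sum as))

multinomial*factProd : ∀ as → multinomial as * factProd as ≡ sum as !
multinomial*factProd as = m/n*n≡m {{factProd≢0 as}} (factProd∣sum! as)

factProd∣member*pred! : ∀ {a} as → a ∈ as → ∀ m → sum as ≡ suc m → factProd as ∣ a * m !
factProd∣member*pred! {zero}  as        _           m _  = _ ∣0
factProd∣member*pred! {suc b} (_ ∷ bs) (here refl) m Σ≡ =
  subst₂ _∣_ (sym (*-assoc (suc b) (b !) (factProd bs)))
             (cong (λ t → suc b * t !) (suc-injective Σ≡))
             (*-monoʳ-∣ (suc b) (factProd∣sum! (b ∷ bs)))
-- In the tail case, Σ bs ≥ a > 0, so Σ bs = s+1 and induction applies.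
factProd∣member*pred! {suc b} (c ∷ bs) (there a∈bs) m Σ≡ with sum bs in Σbs | member≤sum a∈bs
... | zero  | ()
... | suc s | _ = begin
    c ! * factProd bs    ∣⟨ *-monoʳ-∣ (c !) (factProd∣member*pred! bs a∈bs s Σbs) ⟩
    c ! * (suc b * s !)  ≡⟨ *-left-comm (c !) (suc b) (s !) ⟩
    suc b * (c ! * s !)  ∣⟨ *-monoʳ-∣ (suc b) (factorials∣factorial-of-sum c s) ⟩
    suc b * (c + s) !    ≡⟨ cong (λ t → suc b * t !) c+s≡m ⟩
    suc b * m !          ∎
  where
  open ∣-Reasoning
  c+s≡m : c + s ≡ m
  c+s≡m = suc-injective (trans (sym (+-suc c s)) Σ≡)

multiplicity-here : ∀ j xs → multiplicity j (j ∷ xs) ≡ suc (multiplicity j xs)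
multiplicity-here j xs = cong length (filter-accept (_≟ j) {j} {xs} refl)

multiplicity-there : ∀ {x j} xs → x ≢ j → multiplicity j (x ∷ xs) ≡ multiplicity j xs
multiplicity-there {x} {j} xs x≢j = cong length (filter-reject (_≟ j) {x} {xs} x≢j)

multiplicity-∷ : ∀ j x xs → multiplicity j (x ∷ xs) ≡ multiplicity j (x ∷ []) + multiplicity j xs
multiplicity-∷ j x xs with x ≟ j
... | yes refl = trans (multiplicity-here j xs) (cong (_+ multiplicity j xs) (sym (multiplicity-here j [])))
... | no x≢j   = trans (multiplicity-there xs x≢j) (cong (_+ multiplicity j xs) (sym (multiplicity-there [] x≢j)))

sum-indicator : ∀ (w : ℕ → ℕ) x D →
  sum (map (λ d → multiplicity d (x ∷ []) * w d) D) ≡ multiplicity x D * w x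
sum-indicator w x []      = refl
sum-indicator w x (d ∷ D) with x ≟ d
... | yes refl = begin
    multiplicity x (x ∷ []) * w x + sum (map (λ d → multiplicity d (x ∷ []) * w d) D)
      ≡⟨ cong₂ (λ m r → m * w x + r) (multiplicity-here x []) (sum-indicator w x D) ⟩
    1 * w x + multiplicity x D * w x
      ≡⟨ cong (_+ multiplicity x D * w x) (*-identityˡ (w x)) ⟩
    suc (multiplicity x D) * w x
      ≡⟨ cong (_* w x) (sym (multiplicity-here x D)) ⟩
    multiplicity x (x ∷ D) * w x ∎
  where open ≡-Reasoning
... | no x≢d = begin
    multiplicity d (x ∷ []) * w d + sum (map (λ d → multiplicity d (x ∷ []) * w d) D)
      ≡⟨ cong₂ (λ m r → m * w d + r) (multiplicity-there [] x≢d) (sum-indicator w x D) ⟩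
    multiplicity x D * w x
      ≡⟨ cong (_* w x) (sym (multiplicity-there D (λ d≡x → x≢d (sym d≡x)))) ⟩
    multiplicity x (d ∷ D) * w x ∎
  where open ≡-Reasoning

double-count : ∀ (w : ℕ → ℕ) D xs →
  sum (map (λ d → multiplicity d xs * w d) D) ≡ sum (map (λ x → multiplicity x D * w x) xs)
double-count w D []       = sum-zeros D
  where
  sum-zeros : ∀ (D : List ℕ) → sum (map (λ _ → 0) D) ≡ 0
  sum-zeros []      = refl
  sum-zeros (_ ∷ D) = sum-zeros D
double-count w D (x ∷ xs) = begin
    sum (map (λ d → multiplicity d (x ∷ xs) * w d) D)
      ≡⟨ sum-map-cong D (λ {d} _ → trans (cong (_* w d) (multiplicity-∷ d x xs))
                                         (*-distribʳ-+ (w d) (multiplicity d (x ∷ [])) (multiplicity d xs))) ⟩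
    sum (map (λ d → multiplicity d (x ∷ []) * w d + multiplicity d xs * w d) D)
      ≡⟨ sum-map-+ (λ d → multiplicity d (x ∷ []) * w d) (λ d → multiplicity d xs * w d) D ⟩
    sum (map (λ d → multiplicity d (x ∷ []) * w d) D) + sum (map (λ d → multiplicity d xs * w d) D)
      ≡⟨ cong₂ _+_ (sum-indicator w x D) (double-count w D xs) ⟩
    multiplicity x D * w x + sum (map (λ x → multiplicity x D * w x) xs) ∎
  where open ≡-Reasoning

multiplicity-absent : ∀ {x} D → All (x ≢_) D → multiplicity x D ≡ 0
multiplicity-absent []      []           = refl
multiplicity-absent (d ∷ D) (x≢d ∷ x∉D) =
  trans (multiplicity-there D (λ d≡x → x≢d (sym d≡x))) (multiplicity-absent D x∉D)

multiplicity-unique : ∀ {x} D → Unique D → x ∈ D → multiplicity x D ≡ 1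
multiplicity-unique {x} (_ ∷ D) (x∉D ∷ _) (here refl) =
  trans (multiplicity-here x D) (cong suc (multiplicity-absent D x∉D))
multiplicity-unique (d ∷ D) (d∉D ∷ uD) (there x∈D) =
  trans (multiplicity-there D (All.lookup d∉D x∈D)) (multiplicity-unique D uD x∈D)

grouping : ∀ (w : ℕ → ℕ) xs →
  sum (map (λ j → multiplicity j xs * w j) (distinct xs)) ≡ sum (map w xs)
grouping w xs = trans (double-count w (distinct xs) xs) (sum-map-cong xs occurs-once)
  where
  occurs-once : ∀ {x} → x ∈ xs → multiplicity x (distinct xs) * w x ≡ w x
  occurs-once {x} x∈xs =
    trans (cong (_* w x) (multiplicity-unique (distinct xs) (deduplicate-! xs)
                            (Equivalence.to (deduplicate-∈⇔ _≟_) x∈xs)))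
          (*-identityˡ (w x))

sum-multiplicities : ∀ xs → sum (multiplicities xs) ≡ length xs
sum-multiplicities xs = begin
  sum (map (λ j → multiplicity j xs) (distinct xs))
    ≡⟨ sum-map-cong (distinct xs) (λ {j} _ → sym (*-identityʳ (multiplicity j xs))) ⟩
  sum (map (λ j → multiplicity j xs * 1) (distinct xs))
    ≡⟨ grouping (λ _ → 1) xs ⟩
  sum (map (λ _ → 1) xs)
    ≡⟨ sum-ones xs ⟩
  length xs ∎
  where open ≡-Reasoning

sum-by-values : ∀ xs → sum (map (λ j → multiplicity j xs * j) (distinct xs)) ≡ sum xs
sum-by-values xs = trans (grouping (λ x → x) xs) (cong sum (map-id xs))

∣-by-cancellation : ∀ {x q y} F .{{_ : NonZero F}} → x * F ≡ q * y → F ∣ y → q ∣ x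
∣-by-cancellation {x} {q} F xF≡qy (divides c refl) =
  divides c (*-cancelʳ-≡ x (c * q) F (begin
    x * F        ≡⟨ xF≡qy ⟩
    q * (c * F)  ≡⟨ sym (*-assoc q c F) ⟩
    q * c * F    ≡⟨ cong (_* F) (*-comm q c) ⟩
    c * q * F    ∎))
  where open ≡-Reasoning

-- With Σ is = n+1 and length is = q'+1:  ∏ is! · ∏ kₛ!  divides  (n+1)!·q'!,
-- since (n+1)!·q'! = Σⱼ (j·n!)·(kⱼ·q'!) and each factor is handled by
-- factProd∣member*pred! (j is a member of is, kⱼ a member of the multiplicities).
factProds∣ : ∀ is n q' → sum is ≡ suc n → length is ≡ suc q' →
  factProd is * factProd (multiplicities is) ∣ suc n ! * q' !
factProds∣ is n q' Σis≡ len≡ = subst (F ∣_) (sym expand) (∣-sum _ (distinct is) term∣)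
  where
  open ≡-Reasoning
  F : ℕ
  F = factProd is * factProd (multiplicities is)
  k : ℕ → ℕ
  k j = multiplicity j is
  Σks≡ : sum (multiplicities is) ≡ suc q'
  Σks≡ = trans (sum-multiplicities is) len≡
  expand : suc n ! * q' ! ≡ sum (map (λ j → (k j * j) * (n ! * q' !)) (distinct is))
  expand = begin
    suc n ! * q' !                                       ≡⟨ *-assoc (suc n) (n !) (q' !) ⟩
    suc n * (n ! * q' !)                                 ≡⟨ cong (_* (n ! * q' !)) (sym (trans (sum-by-values is) Σis≡)) ⟩
    sum (map (λ j → k j * j) (distinct is)) * (n ! * q' !) ≡⟨ sum-map-*ʳ _ _ (distinct is) ⟩
    sum (map (λ j → (k j * j) * (n ! * q' !)) (distinct is)) ∎
  term∣ : ∀ {j} → j ∈ distinct is → F ∣ (k j * j) * (n ! * q' !)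
  term∣ {j} j∈D = subst (F ∣_) (sym rearrange)
    (*-pres-∣ (factProd∣member*pred! is (Equivalence.from (deduplicate-∈⇔ _≟_) j∈D) n Σis≡)
              (factProd∣member*pred! (multiplicities is) (∈-map⁺ k j∈D) q' Σks≡))
    where
    rearrange : (k j * j) * (n ! * q' !) ≡ (j * n !) * (k j * q' !)
    rearrange = trans (cong (_* (n ! * q' !)) (*-comm (k j) j)) (*-interchange j (k j) (n !) (q' !))

length∣multinomials : ∀ is n → sum is ≡ suc n →
  length is ∣ multinomial is * multinomial (multiplicities is)
length∣multinomials []           n ()
length∣multinomials is@(_ ∷ xs) n Σis≡ =
  ∣-by-cancellation (factProd is * factProd ks) {{nonZero}} product≡ (factProds∣ is n (length xs) Σis≡ refl)
  where
  open ≡-Reasoning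
  ks : List ℕ
  ks = multiplicities is
  nonZero : NonZero (factProd is * factProd ks)
  nonZero = m*n≢0 (factProd is) (factProd ks) {{factProd≢0 is}} {{factProd≢0 ks}}
  product≡ : (multinomial is * multinomial ks) * (factProd is * factProd ks)
           ≡ length is * (suc n ! * length xs !)
  product≡ = begin
    (multinomial is * multinomial ks) * (factProd is * factProd ks)
      ≡⟨ *-interchange (multinomial is) (multinomial ks) (factProd is) (factProd ks) ⟩
    (multinomial is * factProd is) * (multinomial ks * factProd ks)
      ≡⟨ cong₂ _*_ (multinomial*factProd is) (multinomial*factProd ks) ⟩
    sum is ! * sum ks !
      ≡⟨ cong₂ (λ a b → a ! * b !) Σis≡ (sum-multiplicities is) ⟩
    suc n ! * (length is * length xs !)
      ≡⟨ *-left-comm (suc n !) (length is) (length xs !) ⟩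
    length is * (suc n ! * length xs !) ∎

-- The nonzero entry iᵣ makes Σ i positive, and the list of entries has length q
-- (the hypothesis 1 ≤ q is implied by the existence of r).
proposition3p4 : (q : ℕ) → 1 ≤ q → (i : Vec ℕ q) →
    ∃ (λ (r : Fin q) → lookup i r ≢ 0) →
    q ∣ multinomial (toList i) * multinomial (multiplicities (toList i))
proposition3p4 q _ i (r , iᵣ≢0) with sum-positive (∈-toList⁺ (∈-lookup r i)) iᵣ≢0
... | n , Σi≡ =
  subst (_∣ multinomial (toList i) * multinomial (multiplicities (toList i)))
        (length-toList i)
        (length∣multinomials (toList i) n Σi≡)
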